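{- If $k\ge 2$ and $G$ is a connected graph with $\mu(G)=\mu_i(G)$, then $\mu(K_k\,\square\, G)=k\cdot\mu(G)$.
   Context: All graphs are finite, simple, undirected. For $X\subseteq V(G)$, two vertices $x,y\in X$ are $X$-visible if there is a shortest $x,y$-path $P$ in $G$ with $V(P)\cap X=\{x,y\}$; $X$ is a mutual-visibility set if all pairs of its vertices are $X$-visible. $\mu(G)$ is the largest size of a mutual-visibility set of $G$; $\mu_i(G)$ is the largest size of a mutual-visibility set that is an independent set. $K_k$ is the complete graph on $k$ vertices, and $G\,\square\, H$ is the Cartesian product (vertex set $V(G)\times V(H)$, $(g,h)\sim(g',h')$ iff ($gg'\in E(G)$ and $h=h'$) or ($g=g'$ and $hh'\in E(H)$)). -}

module Defs where

open import Data.Nat using (ℕ; zero; suc; _<_; _≤_)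
open import Data.Bool using (Bool; true; false; not; _∧_; _∨_)
open import Data.Fin using (Fin; remQuot; _≟_)
open import Data.Fin.Subset using (Subset; _∈_; ∣_∣)
open import Data.Vec using (Vec; _∷_; []; head; last; lookup)
open import Data.Product using (Σ; ∃; _×_; _,_; proj₁; proj₂)
open import Data.Sum using (_⊎_)
open import Relation.Binary.PropositionalEquality using (_≡_; _≢_)
open import Relation.Nullary using (¬_)
open import Relation.Nullary.Decidable using (⌊_⌋)

Graph : ℕ → Set
Graph n = Fin n → Fin n → Bool

IsSimple : ∀ {n} → Graph n → Set
IsSimple {n} G = (∀ (x y : Fin n) → G x y ≡ G y x) × (∀ (x : Fin n) → G x x ≡ false)

IsWalk : ∀ {n ℓ} → Graph n → Vec (Fin n) (suc ℓ) → Set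
IsWalk G (x ∷ []) = Data.Unit.⊤
  where import Data.Unit
IsWalk G (x ∷ y ∷ vs) = (G x y ≡ true) × IsWalk G (y ∷ vs)

Walk : ∀ {n} → Graph n → ℕ → Fin n → Fin n → Set
Walk {n} G ℓ x y =
  Σ (Vec (Fin n) (suc ℓ)) λ P → IsWalk G P × (head P ≡ x) × (last P ≡ y)

-- A shortest x,y-path: an x,y-walk of length ℓ such that no x,y-walk is shorter
-- (i.e. ℓ = d(x,y); such a walk is automatically a path).
ShortestPath : ∀ {n} → Graph n → ℕ → Fin n → Fin n → Set
ShortestPath G ℓ x y =
  Σ (Walk G ℓ x y) λ _ → ∀ m → m < ℓ → ¬ Walk G m x y

Connected : ∀ {n} → Graph n → Set
Connected {n} G = ∀ (x y : Fin n) → ∃ λ ℓ → Walk G ℓ x y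

Visible : ∀ {n} → Graph n → Subset n → Fin n → Fin n → Set
Visible {n} G X x y =
  ∃ λ ℓ → Σ (ShortestPath G ℓ x y) λ sp →
    ∀ (i : Fin (suc ℓ)) → lookup (proj₁ (proj₁ sp)) i ∈ X →
      (lookup (proj₁ (proj₁ sp)) i ≡ x) ⊎ (lookup (proj₁ (proj₁ sp)) i ≡ y)

IsMutualVisibility : ∀ {n} → Graph n → Subset n → Set
IsMutualVisibility {n} G X = ∀ (x y : Fin n) → x ∈ X → y ∈ X → Visible G X x y

IsIndependent : ∀ {n} → Graph n → Subset n → Set
IsIndependent {n} G X = ∀ (x y : Fin n) → x ∈ X → y ∈ X → G x y ≡ false

IsMu : ∀ {n} → Graph n → ℕ → Set
IsMu {n} G m =
  (Σ (Subset n) λ X → IsMutualVisibility G X × ∣ X ∣ ≡ m) ×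
  (∀ (X : Subset n) → IsMutualVisibility G X → ∣ X ∣ ≤ m)

IsMuI : ∀ {n} → Graph n → ℕ → Set
IsMuI {n} G m =
  (Σ (Subset n) λ X → IsMutualVisibility G X × IsIndependent G X × ∣ X ∣ ≡ m) ×
  (∀ (X : Subset n) → IsMutualVisibility G X → IsIndependent G X → ∣ X ∣ ≤ m)

K : (k : ℕ) → Graph k
K k i j = not ⌊ i ≟ j ⌋

-- Cartesian product G □ H on Fin (m * n); vertex v corresponds to remQuot n v ∈ Fin m × Fin n.
_□_ : ∀ {m n} → Graph m → Graph n → Graph (m Data.Nat.* n)
_□_ {m} {n} G H u v with remQuot {m} n u | remQuot {m} n v
... | (g , h) | (g' , h') =
  (G g g' ∧ ⌊ h ≟ h' ⌋) ∨ (⌊ g ≟ g' ⌋ ∧ H h h')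

{-# OPTIONS --safe #-}
module Submission where

-- Cut K_k □ G into the layers {g} × G. A step inside a fibre K_k × {h} repeats a vertex of the
-- projection to G, so a shortest path between two vertices of one layer never leaves it; hence
-- every layer of a mutual-visibility set of K_k □ G is one of G, and μ(K_k □ G) ≤ k μ(G).
-- Conversely, let S be an independent mutual-visibility set of G of size μ(G) and take all k
-- copies of S. Within a layer, shortest paths of G serve. Between (a, x) and (b, y) with a ≠ b
-- and x ≠ y, walk from x to the next vertex q of a visible shortest x,y-path, cross to layer b
-- and follow the rest of the path: this has length d(x, y) + 1 = d((a, x), (b, y)), and
-- independence of S keeps q out of S.

open import Defs
open import Data.Nat using (ℕ; zero; suc; _≤_; _<_; _*_; _+_; z≤n; s≤s)
open import Data.Nat.Properties using (+-mono-≤; ≤-refl; ≤-<-trans; <-≤-trans; <⇒≤; m<n⇒m<1+n; module ≤-Reasoning)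
open import Data.Bool using (Bool; true; false; _∧_; _∨_)
open import Data.Bool.Properties using (∨-zeroʳ)
open import Data.Fin using (Fin; zero; suc; remQuot; quotient; remainder; combine; _≟_; fromℕ)
open import Data.Fin.Properties using (remQuot-combine; combine-remQuot; combine-injectiveˡ)
open import Data.Fin.Subset using (Subset; _∈_; ∣_∣; inside; outside)
open import Data.Vec using (Vec; _∷_; []; head; last; lookup; map; tabulate; sum; _++_; splitAt)
open import Data.Vec.Properties using ([]=⇒lookup; lookup⇒[]=; lookup-map; lookup∘tabulate; tabulate∘lookup; tabulate-cong; lookup-++ˡ; lookup-++ʳ)
open import Data.Product using (∃; _×_; _,_; proj₁; proj₂)
open import Data.Sum using (_⊎_; inj₁; inj₂)
open import Data.Empty using (⊥-elim)
open import Data.Unit using (tt)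
open import Function using (_∘_)
open import Relation.Binary.PropositionalEquality using (_≡_; _≢_; refl; sym; trans; cong; cong₂; subst; subst₂; module ≡-Reasoning)
open import Relation.Nullary using (¬_; yes; no; contradiction)
open import Relation.Nullary.Decidable using (⌊_⌋)

last-map : ∀ {A B : Set} {ℓ} (f : A → B) (v : Vec A (suc ℓ)) → last (map f v) ≡ f (last v)
last-map f (x ∷ [])    = refl
last-map f (x ∷ y ∷ v) = last-map f (y ∷ v)

head-map : ∀ {A B : Set} {ℓ} (f : A → B) (v : Vec A (suc ℓ)) → head (map f v) ≡ f (head v)
head-map f (x ∷ v) = refl

lookup-fromℕ≡last : ∀ {A : Set} {ℓ} (v : Vec A (suc ℓ)) → lookup v (fromℕ ℓ) ≡ last v
lookup-fromℕ≡last (x ∷ [])    = refl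
lookup-fromℕ≡last (x ∷ y ∷ v) = lookup-fromℕ≡last (y ∷ v)

preimage : ∀ {m n} → (Fin m → Fin n) → Subset n → Subset m
preimage f X = tabulate (lookup X ∘ f)

∈-preimage⁻ : ∀ {m n} {f : Fin m → Fin n} {X i} → i ∈ preimage f X → f i ∈ X
∈-preimage⁻ {f = f} {X} {i} i∈f⁻¹X =
  lookup⇒[]= (f i) X (trans (sym (lookup∘tabulate (lookup X ∘ f) i)) ([]=⇒lookup i∈f⁻¹X))

∣p++q∣≡∣p∣+∣q∣ : ∀ {a b} (p : Subset a) (q : Subset b) → ∣ p ++ q ∣ ≡ ∣ p ∣ + ∣ q ∣
∣p++q∣≡∣p∣+∣q∣ []            q = refl
∣p++q∣≡∣p∣+∣q∣ (inside ∷ p)  q = cong suc (∣p++q∣≡∣p∣+∣q∣ p q)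
∣p++q∣≡∣p∣+∣q∣ (outside ∷ p) q = ∣p++q∣≡∣p∣+∣q∣ p q

sum-tabulate-≤ : ∀ {k c} (f : Fin k → ℕ) → (∀ i → f i ≤ c) → sum (tabulate f) ≤ k * c
sum-tabulate-≤ {zero}  f f≤c = z≤n
sum-tabulate-≤ {suc k} f f≤c = +-mono-≤ (f≤c zero) (sum-tabulate-≤ (f ∘ suc) (f≤c ∘ suc))

sum-tabulate-≡ : ∀ {k c} (f : Fin k → ℕ) → (∀ i → f i ≡ c) → sum (tabulate f) ≡ k * c
sum-tabulate-≡ {zero}  f f≡c = refl
sum-tabulate-≡ {suc k} f f≡c = cong₂ _+_ (f≡c zero) (sum-tabulate-≡ (f ∘ suc) (f≡c ∘ suc))

layer : ∀ {m n} → Subset (m * n) → Fin m → Subset n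
layer X g = preimage (combine g) X

∣X∣≡sum∣layer∣ : ∀ m {n} (X : Subset (m * n)) → ∣ X ∣ ≡ sum (tabulate (∣_∣ ∘ layer {m} X))
∣X∣≡sum∣layer∣ zero    []       = refl
∣X∣≡sum∣layer∣ (suc m) {n} X with splitAt n X
... | p , q , refl = begin
  ∣ p ++ q ∣                                          ≡⟨ ∣p++q∣≡∣p∣+∣q∣ p q ⟩
  ∣ p ∣ + ∣ q ∣                                       ≡⟨ cong₂ _+_ (cong ∣_∣ (sym first-layer)) (∣X∣≡sum∣layer∣ m q) ⟩
  ∣ L zero ∣ + sum (tabulate (∣_∣ ∘ layer {m} {n} q)) ≡⟨ cong (∣ L zero ∣ +_) (cong sum (tabulate-cong (cong ∣_∣ ∘ later-layer))) ⟩
  ∣ L zero ∣ + sum (tabulate (∣_∣ ∘ L ∘ suc))         ∎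
  where
  open ≡-Reasoning
  L : Fin (suc m) → Subset n
  L = layer (p ++ q)
  first-layer : L zero ≡ p
  first-layer = trans (tabulate-cong (lookup-++ˡ p q)) (tabulate∘lookup p)
  later-layer : ∀ g → layer q g ≡ L (suc g)
  later-layer g = sym (tabulate-cong (lookup-++ʳ p q ∘ combine g))

module Walks {n : ℕ} (G : Graph n) where

  suffix-walk : ∀ {ℓ} (Q : Vec (Fin n) (suc ℓ)) → IsWalk G Q → (i : Fin ℓ) →
                ∃ λ ℓ' → ℓ' < ℓ × Walk G ℓ' (lookup Q (suc i)) (last Q)
  suffix-walk (x ∷ y ∷ Q) (_ , w) zero    = _ , ≤-refl , (y ∷ Q , w , refl , refl)
  suffix-walk (x ∷ y ∷ Q) (_ , w) (suc i) with suffix-walk (y ∷ Q) w i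
  ... | ℓ' , ℓ'<ℓ , W = ℓ' , m<n⇒m<1+n ℓ'<ℓ , W

  shortest⇒later≢start : ∀ {ℓ x y} (sp : ShortestPath G ℓ x y) (i : Fin ℓ) →
                          lookup (proj₁ (proj₁ sp)) (suc i) ≢ x
  shortest⇒later≢start ((Q , w , _ , Q↦y) , shortest) i Qᵢ≡x with suffix-walk Q w i
  ... | ℓ' , ℓ'<ℓ , W = shortest ℓ' ℓ'<ℓ (subst₂ (Walk G ℓ') Qᵢ≡x Q↦y W)

  adjacent⇒visible : ∀ {X x y} → x ≢ y → G x y ≡ true → Visible G X x y
  adjacent⇒visible {X} {x} {y} x≢y x~y = 1 , ((x ∷ y ∷ [] , (x~y , tt) , refl , refl) , shortest) , avoid
    where
    shortest : ∀ ℓ → ℓ < 1 → ¬ Walk G ℓ x y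
    shortest zero    _         (z ∷ [] , _ , z≡x , z≡y) = x≢y (trans (sym z≡x) z≡y)
    shortest (suc _) (s≤s ())
    avoid : ∀ t → lookup (x ∷ y ∷ []) t ∈ X → (lookup (x ∷ y ∷ []) t ≡ x) ⊎ (lookup (x ∷ y ∷ []) t ≡ y)
    avoid zero       _ = inj₁ refl
    avoid (suc zero) _ = inj₂ refl

module CartesianProduct {m n : ℕ} (H : Graph m) (G : Graph n) where

  π₁ : Fin (m * n) → Fin m
  π₁ = quotient n

  π₂ : Fin (m * n) → Fin n
  π₂ = remainder {m} n

  π₁-combine : ∀ (g : Fin m) h → π₁ (combine g h) ≡ g
  π₁-combine g h = cong proj₁ (remQuot-combine g h)

  π₂-combine : ∀ (g : Fin m) h → π₂ (combine g h) ≡ h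
  π₂-combine g h = cong proj₂ (remQuot-combine g h)

  combine-π : ∀ u → combine (π₁ u) (π₂ u) ≡ u
  combine-π = combine-remQuot {m} n

  combine-π₂ : ∀ {g : Fin m} u → π₁ u ≡ g → combine g (π₂ u) ≡ u
  combine-π₂ u refl = combine-π u

  adjacency : Fin m × Fin n → Fin m × Fin n → Bool
  adjacency (g , h) (g' , h') = (H g g' ∧ ⌊ h ≟ h' ⌋) ∨ (⌊ g ≟ g' ⌋ ∧ G h h')

  □-unfold : ∀ u v → (H □ G) u v ≡ adjacency (remQuot n u) (remQuot n v)
  □-unfold u v with remQuot {m} n u | remQuot {m} n v
  ... | _ | _ = refl

  □-combine : ∀ (g : Fin m) h g' h' → (H □ G) (combine g h) (combine g' h') ≡ adjacency (g , h) (g' , h')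
  □-combine g h g' h' =
    trans (□-unfold _ _) (cong₂ adjacency (remQuot-combine g h) (remQuot-combine g' h'))

  □-adjacent⇒ : ∀ {u v} → (H □ G) u v ≡ true → (π₁ u ≡ π₁ v × G (π₂ u) (π₂ v) ≡ true) ⊎ (π₂ u ≡ π₂ v)
  □-adjacent⇒ {u} {v} u~v = split (π₁ u) (π₂ u) (π₁ v) (π₂ v) (trans (sym (□-unfold u v)) u~v)
    where
    split : ∀ g h g' h' → adjacency (g , h) (g' , h') ≡ true → (g ≡ g' × G h h' ≡ true) ⊎ (h ≡ h')
    split g h g' h' e with h ≟ h' | g ≟ g' | H g g'
    ... | yes h≡h' | _        | _     = inj₂ h≡h'
    ... | no _     | yes g≡g' | false = inj₁ (g≡g' , e)
    ... | no _     | yes g≡g' | true  = inj₁ (g≡g' , e)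
    split g h g' h' () | no _ | no _ | false
    split g h g' h' () | no _ | no _ | true

  □-edge-in-layer : ∀ (g : Fin m) {h h'} → G h h' ≡ true → (H □ G) (combine g h) (combine g h') ≡ true
  □-edge-in-layer g {h} {h'} h~h' rewrite □-combine g h g h' | h~h' with g ≟ g
  ... | yes _  = ∨-zeroʳ _
  ... | no g≢g = contradiction refl g≢g

  □-edge-in-fibre : ∀ {g g' : Fin m} h → H g g' ≡ true → (H □ G) (combine g h) (combine g' h) ≡ true
  □-edge-in-fibre {g} {g'} h g~g' rewrite □-combine g h g' h | g~g' with h ≟ h
  ... | yes _  = refl
  ... | no h≢h = contradiction refl h≢h

  lift-isWalk : ∀ (g : Fin m) {ℓ} (Q : Vec (Fin n) (suc ℓ)) → IsWalk G Q → IsWalk (H □ G) (map (combine g) Q)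
  lift-isWalk g (x ∷ [])    _         = tt
  lift-isWalk g (x ∷ y ∷ Q) (x~y , w) = □-edge-in-layer g x~y , lift-isWalk g (y ∷ Q) w

  lift-walk : ∀ (g : Fin m) {ℓ x y} → Walk G ℓ x y → Walk (H □ G) ℓ (combine g x) (combine g y)
  lift-walk g (Q , w , Q₀≡x , Q↦y) =
    map (combine g) Q , lift-isWalk g Q w ,
    trans (head-map (combine g) Q) (cong (combine g) Q₀≡x) , trans (last-map (combine g) Q) (cong (combine g) Q↦y)

  project-walk : ∀ {ℓ} (P : Vec (Fin (m * n)) (suc ℓ)) → IsWalk (H □ G) P →
      (IsWalk G (map π₂ P) × (∀ t → π₁ (lookup P t) ≡ π₁ (head P)))
    ⊎ (∃ λ ℓ' → ℓ' < ℓ × Walk G ℓ' (π₂ (head P)) (π₂ (last P)))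
  project-walk (x ∷ []) _ = inj₁ (tt , λ { zero → refl })
  project-walk (x ∷ y ∷ P) (x~y , w) with project-walk (y ∷ P) w | □-adjacent⇒ x~y
  ... | inj₁ (w₂ , flat) | inj₁ (x≡y , x₂~y₂) =
        inj₁ ((x₂~y₂ , w₂) , λ { zero → refl ; (suc t) → trans (flat t) (sym x≡y) })
  ... | inj₁ (w₂ , _) | inj₂ x₂≡y₂ =
        inj₂ (_ , ≤-refl , map π₂ (y ∷ P) , w₂ , sym x₂≡y₂ , last-map π₂ (y ∷ P))
  ... | inj₂ (ℓ' , ℓ'<ℓ , (q ∷ Q) , wQ , refl , Q↦) | inj₁ (_ , x₂~y₂) =
        inj₂ (suc ℓ' , s≤s ℓ'<ℓ , π₂ x ∷ q ∷ Q , (x₂~y₂ , wQ) , refl , Q↦)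
  ... | inj₂ (ℓ' , ℓ'<ℓ , Q , wQ , Q₀≡y₂ , Q↦) | inj₂ x₂≡y₂ =
        inj₂ (ℓ' , m<n⇒m<1+n ℓ'<ℓ , Q , wQ , trans Q₀≡y₂ (sym x₂≡y₂) , Q↦)

  □-walk⇒base-walk : ∀ {ℓ u v} → Walk (H □ G) ℓ u v → ∃ λ ℓ' → ℓ' ≤ ℓ × Walk G ℓ' (π₂ u) (π₂ v)
  □-walk⇒base-walk {ℓ} (P , w , refl , refl) with project-walk P w
  ... | inj₁ (w₂ , _)         = ℓ , ≤-refl , map π₂ P , w₂ , head-map π₂ P , last-map π₂ P
  ... | inj₂ (ℓ' , ℓ'<ℓ , W) = ℓ' , <⇒≤ ℓ'<ℓ , W

  □-walk-across⇒shorter-base-walk : ∀ {ℓ u v} → π₁ u ≢ π₁ v → Walk (H □ G) ℓ u v →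
                                     ∃ λ ℓ' → ℓ' < ℓ × Walk G ℓ' (π₂ u) (π₂ v)
  □-walk-across⇒shorter-base-walk {ℓ} u≢v (P , w , refl , refl) with project-walk P w
  ... | inj₁ (_ , flat) = contradiction (sym (trans (cong π₁ (sym (lookup-fromℕ≡last P))) (flat _))) u≢v
  ... | inj₂ shorter    = shorter

  lift-shortest-path : ∀ (g : Fin m) {ℓ x y} → ShortestPath G ℓ x y → ShortestPath (H □ G) ℓ (combine g x) (combine g y)
  lift-shortest-path g {x = x} {y} (W , shortest) = lift-walk g W , shortest′
    where
    shortest′ : ∀ ℓ' → ℓ' < _ → ¬ Walk (H □ G) ℓ' (combine g x) (combine g y)
    shortest′ ℓ' ℓ'<ℓ W′ with □-walk⇒base-walk W′
    ... | ℓ″ , ℓ″≤ℓ' , W″ =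
      shortest ℓ″ (≤-<-trans ℓ″≤ℓ' ℓ'<ℓ) (subst₂ (Walk G ℓ″) (π₂-combine g x) (π₂-combine g y) W″)

  layer-visible : ∀ {X} (g : Fin m) {x y} → Visible (H □ G) X (combine g x) (combine g y) → Visible G (layer X g) x y
  layer-visible {X} g {x} {y} (ℓ , ((P , w , P₀≡u , P↦v) , shortest) , avoid) with project-walk P w
  ... | inj₂ (ℓ' , ℓ'<ℓ , W) = ⊥-elim (shortest ℓ' ℓ'<ℓ (lift-walk g (subst₂ (Walk G ℓ') P₀≡x P↦y W)))
    where
    P₀≡x = trans (cong π₂ P₀≡u) (π₂-combine g x)
    P↦y = trans (cong π₂ P↦v) (π₂-combine g y)
  ... | inj₁ (w₂ , flat) = ℓ , ((map π₂ P , w₂ , head-π₂ , last-π₂) , shortest₂) , avoid₂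
    where
    head-π₂ : head (map π₂ P) ≡ x
    head-π₂ = trans (head-map π₂ P) (trans (cong π₂ P₀≡u) (π₂-combine g x))
    last-π₂ : last (map π₂ P) ≡ y
    last-π₂ = trans (last-map π₂ P) (trans (cong π₂ P↦v) (π₂-combine g y))
    shortest₂ : ∀ ℓ' → ℓ' < ℓ → ¬ Walk G ℓ' x y
    shortest₂ ℓ' ℓ'<ℓ W = shortest ℓ' ℓ'<ℓ (lift-walk g W)
    in-layer : ∀ t → combine g (π₂ (lookup P t)) ≡ lookup P t
    in-layer t = combine-π₂ (lookup P t) (trans (flat t) (trans (cong π₁ P₀≡u) (π₁-combine g x)))
    avoid₂ : ∀ t → lookup (map π₂ P) t ∈ layer X g →
             (lookup (map π₂ P) t ≡ x) ⊎ (lookup (map π₂ P) t ≡ y)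
    avoid₂ t mem rewrite lookup-map t π₂ P
      with avoid t (subst (_∈ X) (in-layer t) (∈-preimage⁻ mem))
    ... | inj₁ Pₜ≡u = inj₁ (trans (cong π₂ Pₜ≡u) (π₂-combine g x))
    ... | inj₂ Pₜ≡v = inj₂ (trans (cong π₂ Pₜ≡v) (π₂-combine g y))

  layer-mutual-visibility : ∀ {X} → IsMutualVisibility (H □ G) X → ∀ g → IsMutualVisibility G (layer X g)
  layer-mutual-visibility mv g x y x∈ y∈ = layer-visible g (mv _ _ (∈-preimage⁻ x∈) (∈-preimage⁻ y∈))

  ∣X∣≤m*μ : ∀ {μ} → IsMu G μ → ∀ X → IsMutualVisibility (H □ G) X → ∣ X ∣ ≤ m * μ
  ∣X∣≤m*μ (_ , maximal) X mv = begin
    ∣ X ∣                                  ≡⟨ ∣X∣≡sum∣layer∣ m X ⟩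
    sum (tabulate (∣_∣ ∘ layer {m} {n} X)) ≤⟨ sum-tabulate-≤ _ (λ g → maximal (layer X g) (layer-mutual-visibility mv g)) ⟩
    m * _                                  ∎
    where open ≤-Reasoning

  cylinder : Subset n → Subset (m * n)
  cylinder = preimage π₂

  combine∈cylinder⁻ : ∀ {S} {g : Fin m} {h} → combine g h ∈ cylinder S → h ∈ S
  combine∈cylinder⁻ {S} {g} {h} mem = subst (_∈ S) (π₂-combine g h) (∈-preimage⁻ mem)

  ∣cylinder∣ : ∀ S → ∣ cylinder S ∣ ≡ m * ∣ S ∣
  ∣cylinder∣ S = trans (∣X∣≡sum∣layer∣ m (cylinder S)) (sum-tabulate-≡ _ (cong ∣_∣ ∘ layer-cylinder))
    where
    layer-cylinder : ∀ g → layer (cylinder S) g ≡ S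
    layer-cylinder g = trans (tabulate-cong (λ h → trans (lookup∘tabulate (lookup S ∘ π₂) (combine g h))
                                                         (cong (lookup S) (π₂-combine g h))))
                             (tabulate∘lookup S)

  lift-visible : ∀ {S} (g : Fin m) {x y} → Visible G S x y → Visible (H □ G) (cylinder S) (combine g x) (combine g y)
  lift-visible {S} g {x} {y} (ℓ , sp@((Q , _) , _) , avoid) = ℓ , lift-shortest-path g sp , avoid′
    where
    avoid′ : ∀ t → lookup (map (combine g) Q) t ∈ cylinder S →
             (lookup (map (combine g) Q) t ≡ combine g x) ⊎ (lookup (map (combine g) Q) t ≡ combine g y)
    avoid′ t mem rewrite lookup-map t (combine g) Q with avoid t (combine∈cylinder⁻ mem)
    ... | inj₁ Qₜ≡x = inj₁ (cong (combine g) Qₜ≡x)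
    ... | inj₂ Qₜ≡y = inj₂ (cong (combine g) Qₜ≡y)

module CompleteProduct {k n : ℕ} (G : Graph n) (loopless : ∀ x → G x x ≡ false)
                       {S : Subset n} (S-independent : IsIndependent G S) where

  open CartesianProduct (K k) G
  open Walks

  K-adjacent : ∀ {g g' : Fin k} → g ≢ g' → K k g g' ≡ true
  K-adjacent {g} {g'} g≢g' with g ≟ g'
  ... | yes g≡g' = contradiction g≡g' g≢g'
  ... | no _     = refl

  detour-visible : ∀ {a b : Fin k} {x y} → a ≢ b → x ≢ y → x ∈ S → y ∈ S → Visible G S x y →
                   Visible (K k □ G) (cylinder S) (combine a x) (combine b y)
  detour-visible a≢b x≢y _ _ (zero , ((_ ∷ [] , _ , refl , Q↦y) , _) , _) = contradiction Q↦y x≢y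
  detour-visible {a} {b} {x} {y} a≢b x≢y x∈S y∈S
                 (suc ℓ , sp@((_ ∷ q ∷ Q , (x~q , wQ) , refl , Q↦y) , shortest) , avoid) =
    suc (suc ℓ) , ((P , wP , refl , P↦v) , shortest′) , avoid′
    where
    P : Vec (Fin (k * n)) (3 + ℓ)
    P = combine a x ∷ combine a q ∷ map (combine b) (q ∷ Q)
    wP : IsWalk (K k □ G) P
    wP = □-edge-in-layer a x~q , □-edge-in-fibre q (K-adjacent a≢b) , lift-isWalk b (q ∷ Q) wQ
    P↦v : last P ≡ combine b y
    P↦v = trans (last-map (combine b) (q ∷ Q)) (cong (combine b) Q↦y)
    across : π₁ (combine a x) ≢ π₁ (combine b y)
    across e = a≢b (trans (sym (π₁-combine a x)) (trans e (π₁-combine b y)))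
    shortest′ : ∀ ℓ' → ℓ' < 2 + ℓ → ¬ Walk (K k □ G) ℓ' (combine a x) (combine b y)
    shortest′ ℓ' (s≤s ℓ'≤1+ℓ) W with □-walk-across⇒shorter-base-walk across W
    ... | ℓ″ , ℓ″<ℓ' , W″ =
      shortest ℓ″ (<-≤-trans ℓ″<ℓ' ℓ'≤1+ℓ) (subst₂ (Walk G ℓ″) (π₂-combine a x) (π₂-combine b y) W″)
    q∉S : ¬ q ∈ S
    q∉S q∈S with avoid (suc zero) q∈S
    ... | inj₁ q≡x = contradiction (trans (sym (subst (λ z → G x z ≡ true) q≡x x~q)) (loopless x)) λ ()
    ... | inj₂ q≡y = contradiction (trans (sym (subst (λ z → G x z ≡ true) q≡y x~q)) (S-independent x y x∈S y∈S)) λ ()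
    avoid′ : ∀ t → lookup P t ∈ cylinder S → (lookup P t ≡ combine a x) ⊎ (lookup P t ≡ combine b y)
    avoid′ zero          _   = inj₁ refl
    avoid′ (suc zero)    mem = contradiction (combine∈cylinder⁻ mem) q∉S
    avoid′ (suc (suc t)) mem rewrite lookup-map t (combine b) (q ∷ Q)
      with avoid (suc t) (combine∈cylinder⁻ mem)
    ... | inj₁ Qₜ≡x = contradiction Qₜ≡x (shortest⇒later≢start G sp t)
    ... | inj₂ Qₜ≡y = inj₂ (cong (combine b) Qₜ≡y)

  cylinder-mutual-visibility : IsMutualVisibility G S → IsMutualVisibility (K k □ G) (cylinder S)
  cylinder-mutual-visibility S-mv u v u∈ v∈ =
    subst₂ (Visible (K k □ G) (cylinder S)) (combine-π u) (combine-π v)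
      (visible (π₁ u) (π₁ v) (∈-preimage⁻ u∈) (∈-preimage⁻ v∈))
    where
    visible : ∀ a b {x y} → x ∈ S → y ∈ S → Visible (K k □ G) (cylinder S) (combine a x) (combine b y)
    visible a b {x} {y} x∈S y∈S with a ≟ b | x ≟ y
    ... | yes refl | _        = lift-visible a (S-mv x y x∈S y∈S)
    ... | no a≢b   | yes refl = adjacent⇒visible (K k □ G) (a≢b ∘ combine-injectiveˡ a x b x)
                                  (□-edge-in-fibre x (K-adjacent a≢b))
    ... | no a≢b   | no x≢y   = detour-visible a≢b x≢y x∈S y∈S (S-mv x y x∈S y∈S)

theorem3p4 : ∀ (k : ℕ) → 2 ≤ k → ∀ {n} (G : Graph n) → IsSimple G → Connected G →
    ∀ (m : ℕ) → IsMu G m → IsMuI G m → IsMu (K k □ G) (k * m)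
theorem3p4 k _ G (_ , loopless) _ m μ≡m ((S , S-mv , S-independent , ∣S∣≡m) , _) =
  (cylinder S , cylinder-mutual-visibility S-mv , trans (∣cylinder∣ S) (cong (k *_) ∣S∣≡m)) ,
  ∣X∣≤m*μ μ≡m
  where
  open CompleteProduct {k} G loopless S-independent
  open CartesianProduct (K k) G
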